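{- Let $\mathbb{L}$ be one of the logics $\mathbb{PN},\mathbb{PT},\mathbb{PC},\mathbb{PU},\mathbb{PNU},\mathbb{PTU},\mathbb{PCU},\mathbb{PNA},\mathbb{PTA},\mathbb{PCA}$. For every formula $F\in\mathcal{L}$, if $F$ is valid in every model of the class of neighbourhood models corresponding to $\mathbb{L}$, then $F$ is derivable in the axiom system of $\mathbb{L}$.
   Context: Formulas of $\mathcal{L}$ are built from propositional atoms $p$ and $\bot$ by $\wedge,\vee,\rightarrow$ and a binary conditional $>$; $\neg A$ abbreviates $A\rightarrow\bot$ and $\top$ abbreviates $\neg\bot$. A neighbourhood model is a triple $\langle W,N,\llbracket\cdot\rrbracket\rangle$ with $W$ non-empty, $N:W\to\mathcal{P}(\mathcal{P}(W))$, $\llbracket\cdot\rrbracket$ a valuation of atoms, such that every $\alpha\in N(x)$ is non-empty. Forcing: atoms via the valuation, $\bot$ never, Boolean connectives classically; $\alpha\Vdash^\exists A$ means some world of $\alpha$ forces $A$, $\alpha\Vdash^\forall A$ means all worlds of $\alpha$ force $A$; $x\Vdash A>B$ iff for every $\alpha\in N(x)$ with $\alpha\Vdash^\exists A$ there is $\beta\in N(x)$ with $\beta\subseteq\alpha$, $\beta\Vdash^\exists A$ and $\beta\Vdash^\forall A\rightarrow B$. Valid in a model = forced at every world. Model conditions: normality: $N(x)\neq\emptyset$ for all $x$; total reflexivity: for all $x$ there is $\alpha\in N(x)$ with $x\in\alpha$; weak centering: $x\in\alpha$ for all $x$ and $\alpha\in N(x)$; centering: weak centering and $\{x\}\in N(x)$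 for all $x$; uniformity: if $\alpha\in N(x)$ and $y\in\alpha$ then $\bigcup N(x)=\bigcup N(y)$; absoluteness: if $\alpha\in N(x)$ and $y\in\alpha$ then $N(x)=N(y)$. Axiom systems: $\mathbb{PCL}$ consists of classical propositional tautologies, modus ponens, rules (RCEA) from $A\leftrightarrow B$ infer $(A>C)\leftrightarrow(B>C)$, (RCK) from $A\rightarrow B$ infer $(C>A)\rightarrow(C>B)$, axioms (ID) $A>A$, (R-And) $(A>B)\wedge(A>C)\rightarrow(A>(B\wedge C))$, (CM) $(A>B)\wedge(A>C)\rightarrow((A\wedge B)>C)$, (OR) $(A>C)\wedge(B>C)\rightarrow((A\vee B)>C)$. Extra axioms: (N) $\neg(\top>\bot)$; (T) $A\rightarrow\neg(A>\bot)$; (W) $(A>B)\rightarrow(A\rightarrow B)$; (C) $(A\wedge B)\rightarrow(A>B)$; (U$_1$) $(\neg A>\bot)\rightarrow(\neg(\neg A>\bot)>\bot)$; (U$_2$) $\neg(A>\bot)\rightarrow((A>\bot)>\bot)$; (A$_1$) $(A>B)\rightarrow(C>(A>B))$; (A$_2$) $\neg(A>B)\rightarrow(C>\neg(A>B))$. $\mathbb{PN}=\mathbb{PCL}$+(N), $\mathbb{PT}=\mathbb{PN}$+(T), $\mathbb{PW}=\mathbb{PT}$+(W), $\mathbb{PC}=\mathbb{PW}$+(C); $\mathbb{PU}=\mathbb{PCL}$+(U$_1$)+(U$_2$), $\mathbb{PNU}=\mathbb{PU}$+(N), $\mathbb{PTU}=\mathbb{PNU}$+(T), $\mathbb{PWU}=\mathbb{PTU}$+(W),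 $\mathbb{PCU}=\mathbb{PWU}$+(C); $\mathbb{PA}=\mathbb{PCL}$+(A$_1$)+(A$_2$), $\mathbb{PNA}=\mathbb{PA}$+(N), $\mathbb{PTA}=\mathbb{PNA}$+(T), $\mathbb{PWA}=\mathbb{PTA}$+(W), $\mathbb{PCA}=\mathbb{PWA}$+(C). The class of models corresponding to a logic consists of the neighbourhood models satisfying, for each axiom group the logic contains, the associated condition: (N) normality, (T) total reflexivity, (W) weak centering, (C) centering, (U$_1$),(U$_2$) uniformity, (A$_1$),(A$_2$) absoluteness. -}

module Defs where

open import Data.Nat using (ℕ)
open import Data.Bool using (Bool; true; false; _∧_; _∨_; not)
open import Data.Product using (Σ; ∃; _×_; _,_)
open import Data.Sum using (_⊎_)
open import Data.Empty using (⊥)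
open import Relation.Binary.PropositionalEquality using (_≡_)

infixr 6 _∧̇_
infixr 5 _∨̇_
infixr 4 _⇒_
infix 7 _>̇_

data Fm : Set where
  atom : ℕ → Fm
  ⊥̇    : Fm
  _∧̇_  : Fm → Fm → Fm
  _∨̇_  : Fm → Fm → Fm
  _⇒_  : Fm → Fm → Fm
  _>̇_  : Fm → Fm → Fm

¬̇_ : Fm → Fm
¬̇ A = A ⇒ ⊥̇

⊤̇ : Fm
⊤̇ = ¬̇ ⊥̇

_⇔_ : Fm → Fm → Fm
A ⇔ B = (A ⇒ B) ∧̇ (B ⇒ A)

-- Classical propositional tautologies (instances): Boolean evaluation
-- where atoms and conditional formulas A > B are treated as
-- propositional variables.

beval : (Fm → Bool) → Fm → Bool
beval v (atom p)  = v (atom p)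
beval v ⊥̇         = false
beval v (A ∧̇ B)   = beval v A ∧ beval v B
beval v (A ∨̇ B)   = beval v A ∨ beval v B
beval v (A ⇒ B)   = not (beval v A) ∨ beval v B
beval v (A >̇ B)   = v (A >̇ B)

Tautology : Fm → Set
Tautology F = (v : Fm → Bool) → beval v F ≡ true

data Logic : Set where
  PN PT PC PU PNU PTU PCU PNA PTA PCA : Logic

hasN hasT hasW hasC hasU hasA : Logic → Bool
hasN PU = false
hasN _  = true

hasT PT  = true
hasT PC  = true
hasT PTU = true
hasT PCU = true
hasT PTA = true
hasT PCA = true
hasT _   = false

hasW PC  = true
hasW PCU = true
hasW PCA = true
hasW _   = false

hasC PC  = true
hasC PCU = true
hasC PCA = true
hasC _   = false

hasU PU  = true
hasU PNU = true
hasU PTU = true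
hasU PCU = true
hasU _   = false

hasA PNA = true
hasA PTA = true
hasA PCA = true
hasA _   = false

infix 2 _⊢_

data _⊢_ (L : Logic) : Fm → Set where
  taut  : ∀ {F} → Tautology F → L ⊢ F
  mp    : ∀ {A B} → L ⊢ A → L ⊢ A ⇒ B → L ⊢ B
  rcea  : ∀ {A B C} → L ⊢ A ⇔ B → L ⊢ (A >̇ C) ⇔ (B >̇ C)
  rck   : ∀ {A B C} → L ⊢ A ⇒ B → L ⊢ (C >̇ A) ⇒ (C >̇ B)
  ax-id : ∀ {A} → L ⊢ A >̇ A
  ax-rand : ∀ {A B C} → L ⊢ ((A >̇ B) ∧̇ (A >̇ C)) ⇒ (A >̇ (B ∧̇ C))
  ax-cm : ∀ {A B C} → L ⊢ ((A >̇ B) ∧̇ (A >̇ C)) ⇒ ((A ∧̇ B) >̇ C)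
  ax-or : ∀ {A B C} → L ⊢ ((A >̇ C) ∧̇ (B >̇ C)) ⇒ ((A ∨̇ B) >̇ C)
  ax-N  : hasN L ≡ true → L ⊢ ¬̇ (⊤̇ >̇ ⊥̇)
  ax-T  : ∀ {A} → hasT L ≡ true → L ⊢ A ⇒ ¬̇ (A >̇ ⊥̇)
  ax-W  : ∀ {A B} → hasW L ≡ true → L ⊢ (A >̇ B) ⇒ (A ⇒ B)
  ax-C  : ∀ {A B} → hasC L ≡ true → L ⊢ (A ∧̇ B) ⇒ (A >̇ B)
  ax-U1 : ∀ {A} → hasU L ≡ true →
          L ⊢ ((¬̇ A) >̇ ⊥̇) ⇒ ((¬̇ ((¬̇ A) >̇ ⊥̇)) >̇ ⊥̇)
  ax-U2 : ∀ {A} → hasU L ≡ true → L ⊢ (¬̇ (A >̇ ⊥̇)) ⇒ ((A >̇ ⊥̇) >̇ ⊥̇)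
  ax-A1 : ∀ {A B C} → hasA L ≡ true → L ⊢ (A >̇ B) ⇒ (C >̇ (A >̇ B))
  ax-A2 : ∀ {A B C} → hasA L ≡ true → L ⊢ (¬̇ (A >̇ B)) ⇒ (C >̇ (¬̇ (A >̇ B)))

-- Neighbourhood models (subsets of W are characteristic functions W → Bool)

record Model : Set₁ where
  field
    W        : Set
    N        : W → (W → Bool) → Set
    V        : ℕ → W → Bool
    nonempty : ∀ x α → N x α → Σ W λ y → α y ≡ true

module _ (M : Model) where
  open Model M

  _∈_ : W → (W → Bool) → Set
  y ∈ α = α y ≡ true

  _⊆_ : (W → Bool) → (W → Bool) → Set
  β ⊆ α = ∀ y → y ∈ β → y ∈ α

  infix 3 _⊩_
  _⊩_ : W → Fm → Set
  x ⊩ atom p  = V p x ≡ true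
  x ⊩ ⊥̇       = ⊥
  x ⊩ (A ∧̇ B) = (x ⊩ A) × (x ⊩ B)
  x ⊩ (A ∨̇ B) = (x ⊩ A) ⊎ (x ⊩ B)
  x ⊩ (A ⇒ B) = x ⊩ A → x ⊩ B
  x ⊩ (A >̇ B) =
    ∀ α → N x α → (Σ W λ y → y ∈ α × (y ⊩ A)) →
    Σ (W → Bool) λ β → N x β × (β ⊆ α) ×
      (Σ W λ y → y ∈ β × (y ⊩ A)) × (∀ y → y ∈ β → y ⊩ A → y ⊩ B)

  ValidIn : Fm → Set
  ValidIn F = ∀ x → x ⊩ F

  Normality TotalReflexivity WeakCentering Centering Uniformity Absoluteness : Set
  Normality = ∀ x → Σ (W → Bool) λ α → N x α
  TotalReflexivity = ∀ x → Σ (W → Bool) λ α → N x α × x ∈ α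
  WeakCentering = ∀ x α → N x α → x ∈ α
  -- {x} ∈ N(x), up to extensional equality of subsets
  Centering = WeakCentering ×
    (∀ x → Σ (W → Bool) λ α → N x α × (∀ y → (y ∈ α → y ≡ x) × (y ≡ x → y ∈ α)))
  Uniformity = ∀ x α y → N x α → y ∈ α → ∀ z →
    ((Σ (W → Bool) λ γ → N x γ × z ∈ γ) → (Σ (W → Bool) λ γ → N y γ × z ∈ γ)) ×
    ((Σ (W → Bool) λ γ → N y γ × z ∈ γ) → (Σ (W → Bool) λ γ → N x γ × z ∈ γ))
  Absoluteness = ∀ x α y → N x α → y ∈ α → ∀ γ → (N x γ → N y γ) × (N y γ → N x γ)

InClass : Logic → Model → Set
InClass PN  M = Normality M
InClass PT  M = Normality M × TotalReflexivity M
InClass PC  M = Normality M × TotalReflexivity M × WeakCentering M × Centering M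
InClass PU  M = Uniformity M
InClass PNU M = Uniformity M × Normality M
InClass PTU M = Uniformity M × Normality M × TotalReflexivity M
InClass PCU M = Uniformity M × Normality M × TotalReflexivity M × WeakCentering M × Centering M
InClass PNA M = Absoluteness M × Normality M
InClass PTA M = Absoluteness M × Normality M × TotalReflexivity M
InClass PCA M = Absoluteness M × Normality M × TotalReflexivity M × WeakCentering M × Centering M

-- Worlds of the canonical model are maximal consistent sets, built by a Lindenbaum construction
-- along an enumeration of the formulas (excluded middle decides each step). A world w is selected
-- for G at x when it satisfies every X with G > X ∈ x. The neighbourhoods of x are the spheres
-- {w} ∪ {z ∌ G : z selected for some G ∨ Y} around a world w selected for G, the sets
-- {y} ∪ {selected worlds} for y satisfying no A with A > ⊥ ∈ x, and, in centred logics, {x};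
-- centred logics also put x into every neighbourhood. Every neighbourhood containing an A-world
-- contains a sphere whose only A-world is selected for A, which gives the truth lemma for A > B;
-- the frame conditions follow from their axioms. In PCA, (C), (W) and (A₁) make A > B equivalent
-- to A → B, and the model with N(x) = {{x}} is used instead.
module Submission where

open import Axiom.ExcludedMiddle using (ExcludedMiddle)
open import Data.Bool using (Bool; true; false; _∧_; _∨_; not; T)
open import Data.Bool.Properties using (T-∧; T-≡)
import Data.Bool.Properties as Bool
open import Data.Empty using (⊥; ⊥-elim)
open import Data.Fin using (Fin; zero; suc)
open import Data.List using (List; []; _∷_; _++_; cartesianProductWith; concatMap)
open import Data.List.Membership.Propositional using (_∈_)
open import Data.List.Membership.Propositional.Properties
  using (∈-++⁺ˡ; ∈-++⁺ʳ; ∈-cartesianProductWith⁺; ∈-concatMap⁺)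
import Data.List.Relation.Unary.Any as Any
open import Data.List.Relation.Unary.Any using (here; there)
open import Data.Nat using (ℕ; zero; suc; _⊔_; _≤′_; ≤′-reflexive; ≤′-step)
open import Data.Nat.Properties using (m≤m⊔n; m≤n⊔m; ≤⇒≤′)
open import Data.Product using (Σ; _×_; _,_; proj₁; proj₂)
open import Data.Product.Function.NonDependent.Propositional using (_×-⇔_)
import Data.Sum as Sum
open import Data.Sum using (_⊎_; inj₁; inj₂)
open import Data.Sum.Function.Propositional using (_⊎-⇔_)
open import Data.Vec using (Vec; []; _∷_; lookup; map)
open import Data.Vec.Properties using (lookup-map)
open import Function.Base using (_∘_; id)
open import Function.Bundles using (mk⇔; module Equivalence) renaming (_⇔_ to _⟺_)
open import Function.Properties.Equivalence using () renaming (sym to ⟺-sym; trans to ⟺-trans)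
open import Function.Related.TypeIsomorphisms using (→-cong-⇔)
open import Level using (0ℓ)
open import Relation.Binary.PropositionalEquality using (_≡_; refl; sym; trans; cong₂; subst)
open import Relation.Nullary using (Dec; yes; no; ¬_)
open import Relation.Nullary.Decidable using (isYes; toWitness; fromWitness; map′; _×-dec_)
open import Relation.Unary using (Pred; ∅; ｛_｝; _∪_; _⊆_)

open import Defs hiding (_∈_; _⊆_)

open Equivalence using (to; from)

private variable
  n : ℕ
  A B C G X Y φ : Fm

infixr 6 _&_
infixr 5 _∣_
infixr 4 _⟶_
infix 25 _⟨_⟩

data Schema (n : ℕ) : Set where
  var : Fin n → Schema n
  bot : Schema n
  _&_ _∣_ _⟶_ : Schema n → Schema n → Schema n

v₀ : Schema (suc n)
v₀ = var zero

v₁ : Schema (suc (suc n))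
v₁ = var (suc zero)

v₂ : Schema (suc (suc (suc n)))
v₂ = var (suc (suc zero))

_⟨_⟩ : Schema n → Vec Fm n → Fm
var i ⟨ σ ⟩ = lookup σ i
bot ⟨ σ ⟩ = ⊥̇
(P & Q) ⟨ σ ⟩ = P ⟨ σ ⟩ ∧̇ Q ⟨ σ ⟩
(P ∣ Q) ⟨ σ ⟩ = P ⟨ σ ⟩ ∨̇ Q ⟨ σ ⟩
(P ⟶ Q) ⟨ σ ⟩ = P ⟨ σ ⟩ ⇒ Q ⟨ σ ⟩

⟦_⟧ : Schema n → Vec Bool n → Bool
⟦ var i ⟧ ρ = lookup ρ i
⟦ bot ⟧ ρ = false
⟦ P & Q ⟧ ρ = ⟦ P ⟧ ρ ∧ ⟦ Q ⟧ ρ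
⟦ P ∣ Q ⟧ ρ = ⟦ P ⟧ ρ ∨ ⟦ Q ⟧ ρ
⟦ P ⟶ Q ⟧ ρ = not (⟦ P ⟧ ρ) ∨ ⟦ Q ⟧ ρ

beval-⟨⟩ : ∀ v (P : Schema n) σ → beval v (P ⟨ σ ⟩) ≡ ⟦ P ⟧ (map (beval v) σ)
beval-⟨⟩ v (var i) σ = sym (lookup-map i (beval v) σ)
beval-⟨⟩ v bot σ = refl
beval-⟨⟩ v (P & Q) σ = cong₂ _∧_ (beval-⟨⟩ v P σ) (beval-⟨⟩ v Q σ)
beval-⟨⟩ v (P ∣ Q) σ = cong₂ _∨_ (beval-⟨⟩ v P σ) (beval-⟨⟩ v Q σ)
beval-⟨⟩ v (P ⟶ Q) σ = cong₂ (λ a b → not a ∨ b) (beval-⟨⟩ v P σ) (beval-⟨⟩ v Q σ)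

allValuations : ∀ n → (Vec Bool n → Bool) → Bool
allValuations zero k = k []
allValuations (suc n) k = allValuations n (k ∘ (true ∷_)) ∧ allValuations n (k ∘ (false ∷_))

allValuations-sound : {k : Vec Bool n → Bool} → T (allValuations n k) → ∀ ρ → T (k ρ)
allValuations-sound {zero} t [] = t
allValuations-sound {suc n} t (true ∷ ρ) = allValuations-sound (proj₁ (to T-∧ t)) ρ
allValuations-sound {suc n} t (false ∷ ρ) = allValuations-sound (proj₂ (to T-∧ t)) ρ

IsTautology : Schema n → Set
IsTautology {n} P = T (allValuations n ⟦ P ⟧)

instance-tautology : (P : Schema n) → IsTautology P → ∀ σ → Tautology (P ⟨ σ ⟩)
instance-tautology P t σ v rewrite beval-⟨⟩ v P σ =
  to T-≡ (allValuations-sound {k = ⟦ P ⟧} t (map (beval v) σ))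

-- Atoms are ranked by their index, so that there are finitely many formulas of each rank.
rank : Fm → ℕ
rank (atom p) = p
rank ⊥̇ = 0
rank (A ∧̇ B) = suc (rank A ⊔ rank B)
rank (A ∨̇ B) = suc (rank A ⊔ rank B)
rank (A ⇒ B) = suc (rank A ⊔ rank B)
rank (A >̇ B) = suc (rank A ⊔ rank B)

connectives : List (Fm → Fm → Fm)
connectives = _∧̇_ ∷ _∨̇_ ∷ _⇒_ ∷ _>̇_ ∷ []

compounds : List Fm → List Fm
compounds Φ = concatMap (λ _●_ → cartesianProductWith _●_ Φ Φ) connectives

formulasOfRank : ℕ → List Fm
formulasOfRank zero = atom 0 ∷ ⊥̇ ∷ []
formulasOfRank (suc n) = formulasOfRank n ++ atom (suc n) ∷ compounds (formulasOfRank n)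

formulasOfRank-mono : ∀ {m n} → m ≤′ n → A ∈ formulasOfRank m → A ∈ formulasOfRank n
formulasOfRank-mono (≤′-reflexive refl) a = a
formulasOfRank-mono (≤′-step m≤n) a = ∈-++⁺ˡ (formulasOfRank-mono m≤n a)

∈-compound : ∀ {_●_} → _●_ ∈ connectives →
  A ∈ formulasOfRank (rank A) → B ∈ formulasOfRank (rank B) →
  (A ● B) ∈ formulasOfRank (suc (rank A ⊔ rank B))
∈-compound {A} {B} c a b = ∈-++⁺ʳ Φ (there (∈-concatMap⁺ (λ _●_ → cartesianProductWith _●_ Φ Φ)
  (Any.map (λ { refl → ∈-cartesianProductWith⁺ _ a′ b′ }) c)))
  where
  Φ = formulasOfRank (rank A ⊔ rank B)
  a′ = formulasOfRank-mono (≤⇒≤′ (m≤m⊔n (rank A) (rank B))) a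
  b′ = formulasOfRank-mono (≤⇒≤′ (m≤n⊔m (rank A) (rank B))) b

∈-formulasOfRank : ∀ A → A ∈ formulasOfRank (rank A)
∈-formulasOfRank (atom zero) = here refl
∈-formulasOfRank (atom (suc p)) = ∈-++⁺ʳ (formulasOfRank p) (here refl)
∈-formulasOfRank ⊥̇ = there (here refl)
∈-formulasOfRank (A ∧̇ B) = ∈-compound (here refl) (∈-formulasOfRank A) (∈-formulasOfRank B)
∈-formulasOfRank (A ∨̇ B) = ∈-compound (there (here refl)) (∈-formulasOfRank A) (∈-formulasOfRank B)
∈-formulasOfRank (A ⇒ B) =
  ∈-compound (there (there (here refl))) (∈-formulasOfRank A) (∈-formulasOfRank B)
∈-formulasOfRank (A >̇ B) =
  ∈-compound (there (there (there (here refl)))) (∈-formulasOfRank A) (∈-formulasOfRank B)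

hasC⇒hasW : ∀ L → hasC L ≡ true → hasW L ≡ true
hasC⇒hasW PC _ = refl
hasC⇒hasW PCU _ = refl
hasC⇒hasW PCA _ = refl

hasC⇒hasT : ∀ L → hasC L ≡ true → hasT L ≡ true
hasC⇒hasT PC _ = refl
hasC⇒hasT PCU _ = refl
hasC⇒hasT PCA _ = refl

_≐_ : {I : Set} → (I → Bool) → (I → Set) → Set
γ ≐ S = ∀ i → (γ i ≡ true) ⟺ S i

module Classical (em : ExcludedMiddle 0ℓ) where

  χ : {I : Set} → (I → Set) → I → Bool
  χ S i = isYes (em {S i})

  χ-correct : {I : Set} (S : I → Set) {i : I} → (χ S i ≡ true) ⟺ S i
  χ-correct S = mk⇔ (toWitness ∘ from T-≡) (to T-≡ ∘ fromWitness)

  χ-≐ : {I : Set} {S : I → Set} → χ S ≐ S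
  χ-≐ {S = S} i = χ-correct S

  χ-｛｝ : {I : Set} {i : I} → ∀ j → (χ ｛ i ｝ j ≡ true → j ≡ i) × (j ≡ i → χ ｛ i ｝ j ≡ true)
  χ-｛｝ {i = i} j = sym ∘ to (χ-correct ｛ i ｝) , from (χ-correct ｛ i ｝) ∘ sym

module Derivations (L : Logic) where

  tautology : (P : Schema n) {_ : IsTautology P} (σ : Vec Fm n) → L ⊢ P ⟨ σ ⟩
  tautology P {t} σ = taut (instance-tautology P t σ)

  tautological-⇔ : (P Q : Schema n) {_ : IsTautology ((P ⟶ Q) & (Q ⟶ P))} (σ : Vec Fm n) →
    L ⊢ P ⟨ σ ⟩ ⇔ Q ⟨ σ ⟩
  tautological-⇔ P Q {t} = tautology ((P ⟶ Q) & (Q ⟶ P)) {t}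

  ⇔-to : L ⊢ A ⇔ B → L ⊢ A ⇒ B
  ⇔-to A⇔B = mp A⇔B (tautology ((v₀ ⟶ v₁) & (v₁ ⟶ v₀) ⟶ v₀ ⟶ v₁) (_ ∷ _ ∷ []))

  curry : L ⊢ A ∧̇ B ⇒ C → L ⊢ A ⇒ B ⇒ C
  curry f = mp f (tautology ((v₀ & v₁ ⟶ v₂) ⟶ v₀ ⟶ v₁ ⟶ v₂) (_ ∷ _ ∷ _ ∷ []))

  infix 2 _⊢ˢ_

  data _⊢ˢ_ (Γ : Pred Fm 0ℓ) : Fm → Set where
    hyp : Γ A → Γ ⊢ˢ A
    thm : L ⊢ A → Γ ⊢ˢ A
    mp  : Γ ⊢ˢ A → Γ ⊢ˢ A ⇒ B → Γ ⊢ˢ B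

  Consistent : Pred Fm 0ℓ → Set
  Consistent Γ = ¬ (Γ ⊢ˢ ⊥̇)

  ⊢ˢ-mono : ∀ {Γ Δ} → Γ ⊆ Δ → Γ ⊢ˢ A → Δ ⊢ˢ A
  ⊢ˢ-mono Γ⊆Δ (hyp a) = hyp (Γ⊆Δ a)
  ⊢ˢ-mono Γ⊆Δ (thm a) = thm a
  ⊢ˢ-mono Γ⊆Δ (mp d e) = mp (⊢ˢ-mono Γ⊆Δ d) (⊢ˢ-mono Γ⊆Δ e)

  ∅⊢ˢ⇒⊢ : ∅ ⊢ˢ A → L ⊢ A
  ∅⊢ˢ⇒⊢ (thm a) = a
  ∅⊢ˢ⇒⊢ (mp d e) = mp (∅⊢ˢ⇒⊢ d) (∅⊢ˢ⇒⊢ e)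

  deduction : ∀ {Γ} → Γ ∪ ｛ φ ｝ ⊢ˢ A → Γ ⊢ˢ φ ⇒ A
  deduction (hyp (inj₁ a)) = mp (hyp a) (thm (tautology (v₀ ⟶ v₁ ⟶ v₀) (_ ∷ _ ∷ [])))
  deduction (hyp (inj₂ refl)) = thm (tautology (v₀ ⟶ v₀) (_ ∷ []))
  deduction (thm a) = thm (mp a (tautology (v₀ ⟶ v₁ ⟶ v₀) (_ ∷ _ ∷ [])))
  deduction (mp d e) = mp (deduction d) (mp (deduction e)
    (thm (tautology ((v₀ ⟶ v₁ ⟶ v₂) ⟶ (v₀ ⟶ v₁) ⟶ v₀ ⟶ v₂) (_ ∷ _ ∷ _ ∷ []))))

  consistent-¬ : ∀ {Γ} → Consistent Γ → ¬ Consistent (Γ ∪ ｛ φ ｝) → Consistent (Γ ∪ ｛ ¬̇ φ ｝)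
  consistent-¬ c ¬c d¬ = ¬c λ d → c (mp (deduction d) (mp (deduction d¬)
    (thm (tautology (((v₀ ⟶ bot) ⟶ bot) ⟶ (v₀ ⟶ bot) ⟶ bot) (_ ∷ [])))))

module Worlds (L : Logic) where
  open Derivations L

  record World : Set where
    field
      set : Fm → Bool
      consistent : Consistent (λ A → set A ≡ true)
      complete : ∀ A → set A ≡ true ⊎ set (¬̇ A) ≡ true
  open World

  infix 3 _∋_ _∌_

  -- A record rather than a function, so that x and A can be inferred from membership proofs.
  record _∋_ (x : World) (A : Fm) : Set where
    constructor member
    field isMember : set x A ≡ true
  open _∋_

  _∌_ : World → Fm → Set
  x ∌ A = ¬ (x ∋ A)

  private variable
    x : World

  ∋-closed : (x ∋_) ⊢ˢ A → x ∋ A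
  ∋-closed {x} {A} d with complete x A
  ... | inj₁ a = member a
  ... | inj₂ ¬a = ⊥-elim (consistent x (mp (⊢ˢ-mono isMember d) (hyp ¬a)))

  ∋-theorem : L ⊢ A → x ∋ A
  ∋-theorem f = ∋-closed (thm f)

  ∋-mp : x ∋ A → L ⊢ A ⇒ B → x ∋ B
  ∋-mp a f = ∋-closed (mp (hyp a) (thm f))

  ∋-mp₂ : x ∋ A → x ∋ B → L ⊢ A ⇒ B ⇒ C → x ∋ C
  ∋-mp₂ a b f = ∋-closed (mp (hyp b) (mp (hyp a) (thm f)))

  ∌⊥ : x ∌ ⊥̇
  ∌⊥ {x} b = consistent x (hyp (isMember b))

  _∋?_ : ∀ x A → Dec (x ∋ A)
  x ∋? A = map′ member isMember (set x A Bool.≟ true)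

  ∌¬ : x ∌ ¬̇ A → x ∋ A
  ∌¬ {x} {A} ∌¬A with complete x A
  ... | inj₁ a = member a
  ... | inj₂ ¬a = ⊥-elim (∌¬A (member ¬a))

  ∌⇒∋¬ : x ∌ A → x ∋ ¬̇ A
  ∌⇒∋¬ {x} {A} ∌A with complete x A
  ... | inj₁ a = ⊥-elim (∌A (member a))
  ... | inj₂ ¬a = member ¬a

  ∋-¬ : (x ∋ ¬̇ A) ⟺ (x ∌ A)
  ∋-¬ = mk⇔ (λ ¬a a → ∌⊥ (∋-mp₂ a ¬a (tautology (v₀ ⟶ (v₀ ⟶ bot) ⟶ bot) (_ ∷ [])))) ∌⇒∋¬

  ∋-∧ : (x ∋ A ∧̇ B) ⟺ (x ∋ A × x ∋ B)
  ∋-∧ = mk⇔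
    (λ a∧b → ∋-mp a∧b (tautology (v₀ & v₁ ⟶ v₀) (_ ∷ _ ∷ [])) ,
             ∋-mp a∧b (tautology (v₀ & v₁ ⟶ v₁) (_ ∷ _ ∷ [])))
    (λ (a , b) → ∋-mp₂ a b (tautology (v₀ ⟶ v₁ ⟶ v₀ & v₁) (_ ∷ _ ∷ [])))

  ∋-∨ : (x ∋ A ∨̇ B) ⟺ (x ∋ A ⊎ x ∋ B)
  ∋-∨ {x} {A} {B} = mk⇔ cases Sum.[ (λ a → ∋-mp a (tautology (v₀ ⟶ v₀ ∣ v₁) (_ ∷ _ ∷ [])))
                                   , (λ b → ∋-mp b (tautology (v₁ ⟶ v₀ ∣ v₁) (_ ∷ _ ∷ []))) ]
    where
    cases : x ∋ A ∨̇ B → x ∋ A ⊎ x ∋ B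
    cases a∨b with x ∋? A
    ... | yes a = inj₁ a
    ... | no ∌A = inj₂ (∋-mp₂ a∨b (∌⇒∋¬ ∌A) (tautology (v₀ ∣ v₁ ⟶ (v₀ ⟶ bot) ⟶ v₁) (_ ∷ _ ∷ [])))

  ∋-⇒ : (x ∋ A ⇒ B) ⟺ (x ∋ A → x ∋ B)
  ∋-⇒ {x} {A} {B} = mk⇔ (λ a⇒b a → ∋-mp₂ a a⇒b (tautology (v₀ ⟶ (v₀ ⟶ v₁) ⟶ v₁) (_ ∷ _ ∷ []))) intro
    where
    intro : (x ∋ A → x ∋ B) → x ∋ A ⇒ B
    intro a→b with x ∋? A
    ... | yes a = ∋-mp (a→b a) (tautology (v₁ ⟶ v₀ ⟶ v₁) (_ ∷ _ ∷ []))
    ... | no ∌A = ∋-mp (∌⇒∋¬ ∌A) (tautology ((v₀ ⟶ bot) ⟶ v₀ ⟶ v₁) (_ ∷ _ ∷ []))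

  ∌-⇒ : x ∌ A ⇒ B → x ∋ A × x ∌ B
  ∌-⇒ {x} {A} ∌A⇒B with x ∋? A
  ... | yes a = a , λ b → ∌A⇒B (from ∋-⇒ λ _ → b)
  ... | no ∌A = ⊥-elim (∌A⇒B (from ∋-⇒ (⊥-elim ∘ ∌A)))

  REF : x ∋ A >̇ A
  REF = ∋-theorem ax-id

  RW : x ∋ C >̇ A → L ⊢ A ⇒ B → x ∋ C >̇ B
  RW C>A f = ∋-mp C>A (rck f)

  LLE : L ⊢ A ⇔ B → x ∋ A >̇ C → x ∋ B >̇ C
  LLE A⇔B A>C = ∋-mp A>C (⇔-to (rcea A⇔B))

  AND : x ∋ A >̇ B → x ∋ A >̇ C → x ∋ A >̇ (B ∧̇ C)
  AND A>B A>C = ∋-mp₂ A>B A>C (curry ax-rand)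

  CM : x ∋ A >̇ B → x ∋ A >̇ C → x ∋ (A ∧̇ B) >̇ C
  CM A>B A>C = ∋-mp₂ A>B A>C (curry ax-cm)

  OR : x ∋ A >̇ C → x ∋ B >̇ C → x ∋ (A ∨̇ B) >̇ C
  OR A>C B>C = ∋-mp₂ A>C B>C (curry ax-or)

  >-closed : (λ B → x ∋ G >̇ B) ⊢ˢ A → x ∋ G >̇ A
  >-closed (hyp G>A) = G>A
  >-closed (thm a) = RW REF (mp a (tautology (v₁ ⟶ v₀ ⟶ v₁) (_ ∷ _ ∷ [])))
  >-closed (mp d e) =
    RW (AND (>-closed d) (>-closed e)) (tautology (v₀ & (v₀ ⟶ v₁) ⟶ v₁) (_ ∷ _ ∷ []))

  Subset : Set
  Subset = World → Bool

  Neighbourhoods : Set₁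
  Neighbourhoods = World → Subset → Set

  -- The forcing clause of A > B, with the truth sets of A and B abstracted to P and Q.
  Minimal : Neighbourhoods → World → (World → Set) → (World → Set) → Set
  Minimal N x P Q = ∀ α → N x α → (Σ World λ y → α y ≡ true × P y) →
    Σ Subset λ β → N x β × (∀ y → β y ≡ true → α y ≡ true) ×
      (Σ World λ y → β y ≡ true × P y) × (∀ y → β y ≡ true → P y → Q y)

  Minimal-cong : ∀ {N P P′ Q Q′} → (∀ y → P y ⟺ P′ y) → (∀ y → Q y ⟺ Q′ y) →
    Minimal N x P Q → Minimal N x P′ Q′
  Minimal-cong P⟺P′ Q⟺Q′ m α Nα (y , yα , P′y) with m α Nα (y , yα , from (P⟺P′ y) P′y)
  ... | β , Nβ , β⊆α , (z , zβ , Pz) , minimal =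
    β , Nβ , β⊆α , (z , zβ , to (P⟺P′ z) Pz) ,
    λ u uβ P′u → to (Q⟺Q′ u) (minimal u uβ (from (P⟺P′ u) P′u))

  Minimal-∃ : ∀ {N P Q α y} → Minimal N x P Q → N x α → α y ≡ true → P y →
    Σ World λ z → α z ≡ true × P z × Q z
  Minimal-∃ m Nα yα Py with m _ Nα (_ , yα , Py)
  ... | _ , _ , β⊆α , (z , zβ , Pz) , minimal = z , β⊆α z zβ , Pz , minimal z zβ Pz

  module TruthLemma (N : Neighbourhoods) (nonempty : ∀ x α → N x α → Σ World λ y → α y ≡ true)
    (faithful : ∀ x A B → Minimal N x (_∋ A) (_∋ B) ⟺ (x ∋ A >̇ B)) where

    model : Model
    model = record { W = World ; N = N ; V = λ p x → set x (atom p) ; nonempty = nonempty }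

    truth : ∀ A x → _⊩_ model x A ⟺ (x ∋ A)
    truth (atom p) x = mk⇔ member isMember
    truth ⊥̇ x = mk⇔ (λ ()) (⊥-elim ∘ ∌⊥)
    truth (A ∧̇ B) x = ⟺-trans (truth A x ×-⇔ truth B x) (⟺-sym ∋-∧)
    truth (A ∨̇ B) x = ⟺-trans (truth A x ⊎-⇔ truth B x) (⟺-sym ∋-∨)
    truth (A ⇒ B) x = ⟺-trans (→-cong-⇔ (truth A x) (truth B x)) (⟺-sym ∋-⇒)
    truth (A >̇ B) x = ⟺-trans (mk⇔ (Minimal-cong {x} {N} (truth A) (truth B))
      (Minimal-cong {x} {N} (⟺-sym ∘ truth A) (⟺-sym ∘ truth B))) (faithful x A B)

module Lindenbaum (em : ExcludedMiddle 0ℓ) (L : Logic) where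
  open Derivations L
  open Worlds L
  open Classical em

  private variable
    Γ S : Pred Fm 0ℓ

  choice : Fm → Pred Fm 0ℓ → Fm
  choice φ Γ with em {Consistent (Γ ∪ ｛ φ ｝)}
  ... | yes _ = φ
  ... | no _ = ¬̇ φ

  decide : Fm → Pred Fm 0ℓ → Pred Fm 0ℓ
  decide φ Γ = Γ ∪ ｛ choice φ Γ ｝

  decide-consistent : Consistent Γ → Consistent (decide φ Γ)
  decide-consistent {Γ} {φ} c with em {Consistent (Γ ∪ ｛ φ ｝)}
  ... | yes c′ = c′
  ... | no ¬c′ = consistent-¬ c ¬c′

  decide-complete : decide φ Γ φ ⊎ decide φ Γ (¬̇ φ)
  decide-complete {φ} {Γ} with em {Consistent (Γ ∪ ｛ φ ｝)}
  ... | yes _ = inj₁ (inj₂ refl)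
  ... | no _ = inj₂ (inj₂ refl)

  decideAll : List Fm → Pred Fm 0ℓ → Pred Fm 0ℓ
  decideAll [] Γ = Γ
  decideAll (φ ∷ Φ) Γ = decideAll Φ (decide φ Γ)

  decideAll-⊇ : ∀ Φ → Γ ⊆ decideAll Φ Γ
  decideAll-⊇ [] a = a
  decideAll-⊇ (φ ∷ Φ) a = decideAll-⊇ Φ (inj₁ a)

  decideAll-consistent : ∀ Φ → Consistent Γ → Consistent (decideAll Φ Γ)
  decideAll-consistent [] c = c
  decideAll-consistent (φ ∷ Φ) c = decideAll-consistent Φ (decide-consistent c)

  decideAll-complete : ∀ {Φ} → φ ∈ Φ → decideAll Φ Γ φ ⊎ decideAll Φ Γ (¬̇ φ)
  decideAll-complete {Φ = φ ∷ Φ} (here refl) =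
    Sum.map (decideAll-⊇ Φ) (decideAll-⊇ Φ) (decide-complete {φ})
  decideAll-complete (there φ∈Φ) = decideAll-complete φ∈Φ

  stage : Pred Fm 0ℓ → ℕ → Pred Fm 0ℓ
  stage S zero = S
  stage S (suc k) = decideAll (formulasOfRank k) (stage S k)

  stage-mono : ∀ {k k′} → k ≤′ k′ → stage S k ⊆ stage S k′
  stage-mono (≤′-reflexive refl) a = a
  stage-mono {k′ = suc k′} (≤′-step k≤k′) a = decideAll-⊇ (formulasOfRank k′) (stage-mono k≤k′ a)

  stage-consistent : ∀ k → Consistent S → Consistent (stage S k)
  stage-consistent zero c = c
  stage-consistent (suc k) c = decideAll-consistent (formulasOfRank k) (stage-consistent k c)

  limit : Pred Fm 0ℓ → Pred Fm 0ℓ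
  limit S A = Σ ℕ λ k → stage S k A

  limit-compact : limit S ⊢ˢ A → Σ ℕ λ k → stage S k ⊢ˢ A
  limit-compact (hyp (k , a)) = k , hyp a
  limit-compact (thm a) = 0 , thm a
  limit-compact (mp d e) with limit-compact d | limit-compact e
  ... | k , d′ | k′ , e′ = k ⊔ k′ ,
    mp (⊢ˢ-mono (stage-mono (≤⇒≤′ (m≤m⊔n k k′))) d′) (⊢ˢ-mono (stage-mono (≤⇒≤′ (m≤n⊔m k k′))) e′)

  limit-consistent : Consistent S → Consistent (limit S)
  limit-consistent c d with limit-compact d
  ... | k , d′ = stage-consistent k c d′

  limit-complete : ∀ A → limit S A ⊎ limit S (¬̇ A)
  limit-complete A =
    Sum.map (suc (rank A) ,_) (suc (rank A) ,_) (decideAll-complete (∈-formulasOfRank A))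

  lindenbaum : Consistent S → Σ World λ x → ∀ {A} → S A → x ∋ A
  lindenbaum {S} c = x , λ a → member (from ∈limit (0 , a))
    where
    ∈limit : ∀ {A} → (χ (limit S) A ≡ true) ⟺ limit S A
    ∈limit = χ-correct (limit S)
    x : World
    x = record
      { set = χ (limit S)
      ; consistent = limit-consistent c ∘ ⊢ˢ-mono (to ∈limit)
      ; complete = Sum.map (from ∈limit) (from ∈limit) ∘ limit-complete
      }

  in-every-world⇒⊢ : (∀ x → x ∋ A) → L ⊢ A
  in-every-world⇒⊢ {A} ∋A with em {L ⊢ A}
  ... | yes ⊢A = ⊢A
  ... | no ⊬A with lindenbaum consistent
    where
    consistent : Consistent ｛ ¬̇ A ｝
    consistent d = ⊬A (mp (∅⊢ˢ⇒⊢ (deduction (⊢ˢ-mono inj₂ d)))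
      (tautology (((v₀ ⟶ bot) ⟶ bot) ⟶ v₀) (_ ∷ [])))
  ... | x , ∋¬A = ⊥-elim (to ∋-¬ (∋¬A refl) (∋A x))

  module Completeness (N : Neighbourhoods) (nonempty : ∀ x α → N x α → Σ World λ y → α y ≡ true)
    (faithful : ∀ x A B → Minimal N x (_∋ A) (_∋ B) ⟺ (x ∋ A >̇ B)) where
    open TruthLemma N nonempty faithful

    complete : InClass L model → ∀ F → ((M : Model) → InClass L M → ValidIn M F) → L ⊢ F
    complete inClass F valid = in-every-world⇒⊢ λ x → to (truth F x) (valid model inClass x)

module Canonical (em : ExcludedMiddle 0ℓ) (L : Logic) where
  open Derivations L
  open Worlds L
  open Classical em
  open Lindenbaum em L

  private variable
    H : Fm
    w x y z : World
    γ : Subset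

  record Selected (x : World) (G : Fm) (w : World) : Set where
    constructor selected
    field conclusion : x ∋ G >̇ X → w ∋ X
  open Selected

  Selected-⇔ : L ⊢ G ⇔ H → Selected x H w → Selected x G w
  Selected-⇔ G⇔H s = selected (conclusion s ∘ LLE G⇔H)

  Selected-∋ : Selected x G w → w ∋ G
  Selected-∋ s = conclusion s REF

  -- A ∨ H is equivalent to A ∨ (H ∧ ¬ A), and both disjuncts normally imply A ⇒ X.
  Selected-∨ : Selected x (A ∨̇ H) w → w ∋ A → Selected x A w
  Selected-∨ {x} {A} {H} s a = selected λ A>X → to ∋-⇒ (conclusion s (A∨H>A⇒X A>X)) a
    where
    A∨H>A⇒X : x ∋ A >̇ X → x ∋ (A ∨̇ H) >̇ (A ⇒ X)
    A∨H>A⇒X A>X = LLE (tautological-⇔ (v₀ ∣ v₁ & (v₀ ⟶ bot)) (v₀ ∣ v₁) (_ ∷ _ ∷ []))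
      (OR (RW A>X (tautology (v₁ ⟶ v₀ ⟶ v₁) (_ ∷ _ ∷ [])))
          (RW REF (tautology (v₁ & (v₀ ⟶ bot) ⟶ v₀ ⟶ v₂) (_ ∷ _ ∷ _ ∷ []))))

  refute : x ∌ G >̇ Y → Σ World λ w → Selected x G w × w ∌ Y
  refute {x} {G} {Y} ∌G>Y with lindenbaum consistent
    where
    consistent : Consistent ((λ B → x ∋ G >̇ B) ∪ ｛ ¬̇ Y ｝)
    consistent d = ∌G>Y (RW (>-closed (deduction d)) (tautology (((v₀ ⟶ bot) ⟶ bot) ⟶ v₀) (_ ∷ [])))
  ... | w , sub = w , selected (sub ∘ inj₁) , to ∋-¬ (sub (inj₂ refl))

  CM-∨ : x ∋ (A ∨̇ C) >̇ C → x ∋ (A ∨̇ C) >̇ X → x ∋ C >̇ X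
  CM-∨ A∨C>C A∨C>X = LLE (tautological-⇔ ((v₀ ∣ v₁) & v₁) v₁ (_ ∷ _ ∷ [])) (CM A∨C>C A∨C>X)

  Selected-∨-or-escape : Selected x C w →
    Selected x (A ∨̇ C) w ⊎ Σ World λ u → Selected x (A ∨̇ C) u × u ∋ A × u ∌ C
  Selected-∨-or-escape {x} {C} {A = A} s with x ∋? ((A ∨̇ C) >̇ C)
  ... | yes A∨C>C = inj₁ (selected (conclusion s ∘ CM-∨ A∨C>C))
  ... | no ∌A∨C>C with refute ∌A∨C>C
  ... | u , s′ , u∌C = inj₂ (u , s′ , Sum.[ id , ⊥-elim ∘ u∌C ] (to ∋-∨ (Selected-∋ s′)) , u∌C)

  Selected-escape : Selected x (C ∨̇ X) y → y ∋ A → y ∌ C →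
    Σ World λ u → Selected x (A ∨̇ C ∨̇ X) u × u ∋ A × u ∌ C
  Selected-escape {x} {C} {X} {A = A} s a ∌C with x ∋? ((A ∨̇ C ∨̇ X) >̇ (A ⇒ C))
  ... | yes G>A⇒C = ⊥-elim (∌C (to ∋-⇒ (conclusion s (CM-∨ G>C∨X G>A⇒C)) a))
    where
    G>C∨X = RW (AND REF G>A⇒C) (tautology ((v₀ ∣ v₁ ∣ v₂) & (v₀ ⟶ v₁) ⟶ v₁ ∣ v₂) (_ ∷ _ ∷ _ ∷ []))
  ... | no ∌G>A⇒C with refute ∌G>A⇒C
  ... | u , s′ , u∌A⇒C = u , s′ , ∌-⇒ u∌A⇒C

  Outside : World → Fm → Pred World 0ℓ
  Outside x G z = z ∌ G × Σ Fm λ Y → Selected x (G ∨̇ Y) z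

  Core : World → Fm → World → Pred World 0ℓ
  Core x G w = ｛ w ｝ ∪ Outside x G

  Centre : World → Pred World 0ℓ
  Centre x z = hasC L ≡ true × x ≡ z

  Sphere : World → Fm → World → Pred World 0ℓ
  Sphere x G w = Core x G w ∪ Centre x

  Outside-⇒ : L ⊢ C ⇒ G → Outside x G ⊆ Outside x C
  Outside-⇒ C⇒G (z∌G , Y , s) = (λ c → z∌G (∋-mp c C⇒G)) , _ , Selected-⇔ C∨G∨Y⇔G∨Y s
    where
    C∨G∨Y⇔G∨Y = mp C⇒G
      (tautology ((v₀ ⟶ v₁) ⟶ (v₀ ∣ v₁ ∣ v₂ ⟶ v₁ ∣ v₂) & (v₁ ∣ v₂ ⟶ v₀ ∣ v₁ ∣ v₂)) (_ ∷ _ ∷ _ ∷ []))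

  Core-refine : Selected x G w → Core x G w z → z ∋ A →
    Σ World λ u → Σ Fm λ H → Selected x (A ∨̇ H) u × u ∋ A × Core x (A ∨̇ H) u ⊆ Core x G w
  Core-refine {G = G} {A = A} s (inj₁ refl) a with Selected-∨-or-escape {A = A} s
  ... | inj₁ s′ = _ , G , s′ , a , Sum.map₂ (Outside-⇒ (tautology (v₁ ⟶ v₀ ∣ v₁) (_ ∷ _ ∷ [])))
  ... | inj₂ (u , s′ , uA , u∌G) = u , G , s′ , uA , λ where
    (inj₁ refl) → inj₂ (u∌G , A , Selected-⇔ (tautological-⇔ (v₁ ∣ v₀) (v₀ ∣ v₁) (_ ∷ _ ∷ [])) s′)
    (inj₂ o) → inj₂ (Outside-⇒ (tautology (v₁ ⟶ v₀ ∣ v₁) (_ ∷ _ ∷ [])) o)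
  Core-refine {G = G} {A = A} s (inj₂ (z∌G , X , s₀)) a with Selected-escape s₀ a z∌G
  ... | u , s′ , uA , u∌G = u , G ∨̇ X , s′ , uA , λ where
    (inj₁ refl) → inj₂ (u∌G , A ∨̇ X ,
      Selected-⇔ (tautological-⇔ (v₁ ∣ v₀ ∣ v₂) (v₀ ∣ v₁ ∣ v₂) (_ ∷ _ ∷ _ ∷ [])) s′)
    (inj₂ o) → inj₂ (Outside-⇒ (tautology (v₁ ⟶ v₀ ∣ v₁ ∣ v₂) (_ ∷ _ ∷ _ ∷ [])) o)

  Reachable : World → Pred World 0ℓ
  Reachable x z = Σ Fm λ G → Selected x G z

  Core-reachable : Selected x G w → Core x G w ⊆ Reachable x
  Core-reachable s (inj₁ refl) = _ , s
  Core-reachable s (inj₂ (_ , _ , s′)) = _ , s′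

  record Compatible (x y : World) : Set where
    constructor compatible
    field possible : x ∋ A >̇ ⊥̇ → y ∌ A
  open Compatible

  -- G is equivalent to (G ∧ A) ∨ (G ∧ ¬ A), and both disjuncts normally imply ¬ A once A > ⊥.
  Selected-compatible : Selected x G w → Compatible x w
  Selected-compatible {x} {G} s = compatible λ A>⊥ → to ∋-¬ (conclusion s (G>¬A A>⊥))
    where
    G>¬A : x ∋ A >̇ ⊥̇ → x ∋ G >̇ ¬̇ A
    G>¬A A>⊥ = LLE (tautological-⇔ (v₀ & v₁ ∣ v₀ & (v₁ ⟶ bot)) v₀ (_ ∷ _ ∷ []))
      (OR (RW (LLE (tautological-⇔ (v₁ & v₀) (v₀ & v₁) (_ ∷ _ ∷ []))
                   (CM (RW A>⊥ (tautology (bot ⟶ v₀) (_ ∷ []))) A>⊥))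
              (tautology (bot ⟶ v₀ ⟶ bot) (_ ∷ [])))
          (RW REF (tautology (v₀ & (v₁ ⟶ bot) ⟶ v₁ ⟶ bot) (_ ∷ _ ∷ []))))

  Compatible-refl : hasT L ≡ true → Compatible x x
  Compatible-refl hT = compatible λ A>⊥ a → to ∋-¬ (∋-mp a (ax-T hT)) A>⊥

  Compatible-selected : Compatible x y → y ∋ A → Σ World λ w → Selected x (A ∨̇ ⊥̇) w × w ∋ A
  Compatible-selected {x} {A = A} c a with x ∋? ((A ∨̇ ⊥̇) >̇ ⊥̇)
  ... | yes A∨⊥>⊥ = ⊥-elim (possible c (LLE (tautological-⇔ (v₀ ∣ bot) v₀ (_ ∷ [])) A∨⊥>⊥) a)
  ... | no ∌A∨⊥>⊥ with refute ∌A∨⊥>⊥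
  ... | w , s , _ = w , s , ∋-mp (Selected-∋ s) (tautology (v₀ ∣ bot ⟶ v₀) (_ ∷ []))

  data Nbhd (x : World) (γ : Subset) : Set where
    sphere : Selected x G w → γ ≐ Sphere x G w → Nbhd x γ
    top : Compatible x y → γ ≐ ((｛ y ｝ ∪ Reachable x) ∪ Centre x) → Nbhd x γ
    centre : hasC L ≡ true → γ ≐ ｛ x ｝ → Nbhd x γ

  Nbhd-nonempty : ∀ x γ → Nbhd x γ → Σ World λ y → γ y ≡ true
  Nbhd-nonempty x γ (sphere {w = w} _ γ≐) = w , from (γ≐ w) (inj₁ (inj₁ refl))
  Nbhd-nonempty x γ (top {y} _ γ≐) = y , from (γ≐ y) (inj₁ (inj₁ refl))
  Nbhd-nonempty x γ (centre _ γ≐) = x , from (γ≐ x) refl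

  Nbhd-centred : hasC L ≡ true → Nbhd x γ → γ x ≡ true
  Nbhd-centred {x} hC (sphere _ γ≐) = from (γ≐ x) (inj₂ (hC , refl))
  Nbhd-centred {x} hC (top _ γ≐) = from (γ≐ x) (inj₂ (hC , refl))
  Nbhd-centred {x} hC (centre _ γ≐) = from (γ≐ x) refl

  Nbhd-compatible : Nbhd x γ → γ z ≡ true → Compatible x z
  Nbhd-compatible {z = z} (sphere s γ≐) zγ with to (γ≐ z) zγ
  ... | inj₁ zS = Selected-compatible (proj₂ (Core-reachable s zS))
  ... | inj₂ (hC , refl) = Compatible-refl (hasC⇒hasT L hC)
  Nbhd-compatible {z = z} (top c γ≐) zγ with to (γ≐ z) zγ
  ... | inj₁ (inj₁ refl) = c
  ... | inj₁ (inj₂ (_ , s)) = Selected-compatible s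
  ... | inj₂ (hC , refl) = Compatible-refl (hasC⇒hasT L hC)
  Nbhd-compatible {z = z} (centre hC γ≐) zγ with to (γ≐ z) zγ
  ... | refl = Compatible-refl (hasC⇒hasT L hC)

  AtCentre : World → Fm → Set
  AtCentre x A = hasC L ≡ true × x ∋ A

  atCentre? : ∀ x A → Dec (AtCentre x A)
  atCentre? x A = (hasC L Bool.≟ true) ×-dec (x ∋? A)

  Nbhd-refine : Nbhd x γ → γ z ≡ true → z ∋ A → ¬ AtCentre x A →
    Σ World λ w → Σ Fm λ H →
      Selected x (A ∨̇ H) w × w ∋ A × Sphere x (A ∨̇ H) w ⊆ (λ u → γ u ≡ true)
  Nbhd-refine {z = z} (sphere s γ≐) zγ a ¬c with to (γ≐ z) zγ
  ... | inj₂ (hC , refl) = ⊥-elim (¬c (hC , a))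
  ... | inj₁ zS with Core-refine s zS a
  ... | w , H , s′ , wA , ⊆S = w , H , s′ , wA , λ {u} → from (γ≐ u) ∘ Sum.map₁ ⊆S
  Nbhd-refine {z = z} (top c γ≐) zγ a ¬c with to (γ≐ z) zγ
  ... | inj₂ (hC , refl) = ⊥-elim (¬c (hC , a))
  ... | inj₁ _ with Compatible-selected (Nbhd-compatible (top c γ≐) zγ) a
  ... | w , s , wA = w , ⊥̇ , s , wA , λ {u} → from (γ≐ u) ∘ Sum.map₁ (inj₂ ∘ Core-reachable s)
  Nbhd-refine {z = z} (centre hC γ≐) zγ a ¬c with to (γ≐ z) zγ
  ... | refl = ⊥-elim (¬c (hC , a))

  Sphere-∋-unique : Sphere x (A ∨̇ H) w y → y ∋ A → ¬ AtCentre x A → w ≡ y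
  Sphere-∋-unique (inj₁ (inj₁ w≡y)) _ _ = w≡y
  Sphere-∋-unique (inj₁ (inj₂ (y∌A∨H , _))) yA _ =
    ⊥-elim (y∌A∨H (∋-mp yA (tautology (v₀ ⟶ v₀ ∣ v₁) (_ ∷ _ ∷ []))))
  Sphere-∋-unique (inj₂ (hC , refl)) yA ¬c = ⊥-elim (¬c (hC , yA))

  ∋⇒Minimal : x ∋ A >̇ B → Minimal Nbhd x (_∋ A) (_∋ B)
  ∋⇒Minimal {x} {A} {B} A>B α Nα (z , zα , zA) with atCentre? x A
  ... | yes (hC , xA) = χ ｛ x ｝ , centre hC χ-≐ ,
    (λ y yβ → subst (λ u → α u ≡ true) (sym (proj₁ (χ-｛｝ y) yβ)) (Nbhd-centred hC Nα)) ,
    (x , proj₂ (χ-｛｝ x) refl , xA) ,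
    λ y yβ _ → subst (_∋ B) (sym (proj₁ (χ-｛｝ y) yβ)) (∋-mp₂ A>B xA (ax-W (hasC⇒hasW L hC)))
  ... | no ¬c with Nbhd-refine Nα zα zA ¬c
  ... | w , H , s , wA , S⊆α = χ S , sphere s χ-≐ , (λ y yβ → S⊆α (to (χ-correct S) yβ)) ,
    (w , from (χ-correct S) (inj₁ (inj₁ refl)) , wA) ,
    λ y yβ yA → subst (_∋ B) (Sphere-∋-unique (to (χ-correct S) yβ) yA ¬c)
      (conclusion (Selected-∨ s wA) A>B)
    where
    S = Sphere x (A ∨̇ H) w

  Minimal-centre : AtCentre x A → Minimal Nbhd x (_∋ A) (_∋ B) → x ∋ B
  Minimal-centre {x} (hC , xA) m
    with Minimal-∃ {N = Nbhd} m (centre hC χ-≐) (proj₂ (χ-｛｝ x) refl) xA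
  ... | y , y∈｛x｝ , _ , yB = subst (_∋ _) (proj₁ (χ-｛｝ y) y∈｛x｝) yB

  Minimal-sphere : Selected x (A ∨̇ H) w → w ∋ A → ¬ AtCentre x A →
    Minimal Nbhd x (_∋ A) (_∋ B) → w ∋ B
  Minimal-sphere {x} {A} {H} {w} {B} s wA ¬c m =
    conclude (Minimal-∃ {N = Nbhd} m (sphere s χ-≐) (from (χ-correct S) (inj₁ (inj₁ refl))) wA)
    where
    S = Sphere x (A ∨̇ H) w
    conclude : (Σ World λ y → χ S y ≡ true × y ∋ A × y ∋ B) → w ∋ B
    conclude (y , yS , yA , yB) =
      subst (_∋ B) (sym (Sphere-∋-unique (to (χ-correct S) yS) yA ¬c)) yB

  Minimal⇒∋ : Minimal Nbhd x (_∋ A) (_∋ B) → x ∋ A >̇ B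
  Minimal⇒∋ {x} {A} {B} m with x ∋? (A >̇ B) | atCentre? x A
  ... | yes A>B | _ = A>B
  ... | no _ | yes (hC , xA) = ∋-mp₂ xA (Minimal-centre (hC , xA) m) (curry (ax-C hC))
  ... | no ∌A>B | no ¬c with refute ∌A>B
  ... | w , s , w∌B = ⊥-elim (w∌B (Minimal-sphere A∨⊥-selected (Selected-∋ s) ¬c m))
    where
    A∨⊥-selected = Selected-⇔ (tautological-⇔ (v₀ ∣ bot) v₀ (_ ∷ [])) s

  faithful : ∀ x A B → Minimal Nbhd x (_∋ A) (_∋ B) ⟺ (x ∋ A >̇ B)
  faithful x A B = mk⇔ Minimal⇒∋ ∋⇒Minimal

  open TruthLemma Nbhd Nbhd-nonempty faithful using (model)
  open Completeness Nbhd Nbhd-nonempty faithful public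

  normal : hasN L ≡ true → Normality model
  normal hN x with refute {G = ⊤̇} {⊥̇} (to ∋-¬ (∋-theorem (ax-N hN)))
  ... | w , s , _ = χ (Sphere x ⊤̇ w) , sphere s χ-≐

  Compatible-covered : Compatible x z → Σ Subset λ γ → Nbhd x γ × γ z ≡ true
  Compatible-covered {x} {z} c = χ S , top c χ-≐ , from (χ-correct S) (inj₁ (inj₁ refl))
    where
    S = (｛ z ｝ ∪ Reachable x) ∪ Centre x

  totallyReflexive : hasT L ≡ true → TotalReflexivity model
  totallyReflexive hT x = Compatible-covered (Compatible-refl hT)

  weaklyCentred : hasC L ≡ true → WeakCentering model
  weaklyCentred hC x α Nα = Nbhd-centred hC Nα

  centred : hasC L ≡ true → Centering model
  centred hC = weaklyCentred hC , λ x → χ ｛ x ｝ , centre hC χ-≐ , χ-｛｝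

  Compatible-□ : hasU L ≡ true → Compatible x y → (x ∋ A >̇ ⊥̇) ⟺ (y ∋ A >̇ ⊥̇)
  Compatible-□ hU c = mk⇔
    (λ A>⊥ → LLE (tautological-⇔ ((v₀ ⟶ bot) ⟶ bot) v₀ (_ ∷ []))
      (∌¬ (possible c (∋-mp (LLE (tautological-⇔ v₀ ((v₀ ⟶ bot) ⟶ bot) (_ ∷ [])) A>⊥) (ax-U1 hU)))))
    (λ A>⊥ → ∌¬ λ ¬A>⊥ → possible c (∋-mp ¬A>⊥ (ax-U2 hU)) A>⊥)

  uniform : hasU L ≡ true → Uniformity model
  uniform hU x α y Nα yα z =
    (λ (_ , Nγ , zγ) → Compatible-covered (compatible (possible (Nbhd-compatible Nγ zγ) ∘ from □))) ,
    (λ (_ , Nγ , zγ) → Compatible-covered (compatible (possible (Nbhd-compatible Nγ zγ) ∘ to □)))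
    where
    □ : (x ∋ A >̇ ⊥̇) ⟺ (y ∋ A >̇ ⊥̇)
    □ = Compatible-□ hU (Nbhd-compatible Nα yα)

  Compatible-∋ : Compatible x y → x ∋ ¬̇ C >̇ C → y ∋ C
  Compatible-∋ c ¬C>C =
    ∌¬ (possible c (RW (AND REF ¬C>C) (tautology ((v₀ ⟶ bot) & v₀ ⟶ bot) (_ ∷ []))))

  Compatible-conditionals : hasA L ≡ true → Compatible x y → (x ∋ A >̇ B) ⟺ (y ∋ A >̇ B)
  Compatible-conditionals hA c = mk⇔
    (λ A>B → Compatible-∋ c (∋-mp A>B (ax-A1 hA)))
    (λ A>B → ∌¬ λ ¬A>B → to ∋-¬ (Compatible-∋ c (LLE ¬¬-intro (∋-mp ¬A>B (ax-A2 hA)))) A>B)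
    where
    ¬¬-intro = tautological-⇔ v₀ ((v₀ ⟶ bot) ⟶ bot) (_ ∷ [])

  ConditionalsIn : World → World → Set
  ConditionalsIn x y = ∀ {A B} → x ∋ A >̇ B → y ∋ A >̇ B

  module _ (y⊑x : ConditionalsIn y x) where

    Selected-transfer : Selected x G w → Selected y G w
    Selected-transfer s = selected (conclusion s ∘ y⊑x)

    Core-transfer : Core x G w ⊆ Core y G w
    Core-transfer (inj₁ refl) = inj₁ refl
    Core-transfer (inj₂ (z∌G , Y , s)) = inj₂ (z∌G , Y , Selected-transfer s)

    Reachable-transfer : Reachable x ⊆ Reachable y
    Reachable-transfer (G , s) = G , Selected-transfer s

    Compatible-transfer : Compatible x z → Compatible y z
    Compatible-transfer c = compatible (possible c ∘ y⊑x)

  ¬hasC : hasC L ≡ false → ¬ (hasC L ≡ true)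
  ¬hasC hC hC′ with trans (sym hC′) hC
  ... | ()

  Nbhd-transfer : hasC L ≡ false → ConditionalsIn x y → ConditionalsIn y x → Nbhd x γ → Nbhd y γ
  Nbhd-transfer hC x⊑y y⊑x (sphere s γ≐) = sphere (Selected-transfer y⊑x s) λ z → ⟺-trans (γ≐ z)
    (mk⇔ (Sum.map (Core-transfer y⊑x) (⊥-elim ∘ ¬hasC hC ∘ proj₁))
         (Sum.map (Core-transfer x⊑y) (⊥-elim ∘ ¬hasC hC ∘ proj₁)))
  Nbhd-transfer hC x⊑y y⊑x (top c γ≐) = top (Compatible-transfer y⊑x c) λ z → ⟺-trans (γ≐ z)
    (mk⇔ (Sum.map (Sum.map₂ (Reachable-transfer y⊑x)) (⊥-elim ∘ ¬hasC hC ∘ proj₁))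
         (Sum.map (Sum.map₂ (Reachable-transfer x⊑y)) (⊥-elim ∘ ¬hasC hC ∘ proj₁)))
  Nbhd-transfer hC x⊑y y⊑x (centre hC′ _) = ⊥-elim (¬hasC hC hC′)

  absolute : hasA L ≡ true → hasC L ≡ false → Absoluteness model
  absolute hA hC x α y Nα yα γ =
    Nbhd-transfer hC (to same) (from same) , Nbhd-transfer hC (from same) (to same)
    where
    same : (x ∋ A >̇ B) ⟺ (y ∋ A >̇ B)
    same = Compatible-conditionals hA (Nbhd-compatible Nα yα)

module Degenerate (em : ExcludedMiddle 0ℓ) (L : Logic) (hC : hasC L ≡ true) (hA : hasA L ≡ true)
  where
  open Derivations L
  open Worlds L
  open Classical em
  open Lindenbaum em L

  private variable
    x : World

  Nbhd : Neighbourhoods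
  Nbhd x γ = γ ≐ ｛ x ｝

  Nbhd-nonempty : ∀ x γ → Nbhd x γ → Σ World λ y → γ y ≡ true
  Nbhd-nonempty x γ γ≐ = x , from (γ≐ x) refl

  -- ⊤ > ¬ A holds by (C), so A > (⊤ > ¬ A) by (A₁), hence A > ¬ A by (W).
  ∌⇒impossible : x ∌ A → x ∋ A >̇ ⊥̇
  ∌⇒impossible {x} {A} ∌A = RW (AND REF A>¬A) (tautology (v₀ & (v₀ ⟶ bot) ⟶ bot) (_ ∷ []))
    where
    ⊤>¬A : x ∋ ⊤̇ >̇ ¬̇ A
    ⊤>¬A = ∋-mp₂ (∋-theorem (tautology (bot ⟶ bot) [])) (∌⇒∋¬ ∌A) (curry (ax-C hC))
    A>¬A : x ∋ A >̇ ¬̇ A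
    A>¬A = RW (∋-mp ⊤>¬A (ax-A1 hA))
      (mp (ax-W (hasC⇒hasW L hC)) (tautology ((v₀ ⟶ (bot ⟶ bot) ⟶ v₁) ⟶ v₀ ⟶ v₁) (_ ∷ _ ∷ [])))

  ∋⇒Minimal : x ∋ A >̇ B → Minimal Nbhd x (_∋ A) (_∋ B)
  ∋⇒Minimal {x} {A} {B} A>B α α≐ (z , zα , zA) = α , α≐ , (λ _ yα → yα) , (z , zα , zA) , minimal
    where
    minimal : ∀ y → α y ≡ true → y ∋ A → y ∋ B
    minimal y yα with to (α≐ y) yα
    ... | refl = λ xA → ∋-mp₂ A>B xA (ax-W (hasC⇒hasW L hC))

  Minimal⇒∋ : Minimal Nbhd x (_∋ A) (_∋ B) → x ∋ A >̇ B
  Minimal⇒∋ {x} {A} {B} m with x ∋? (A >̇ B) | x ∋? A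
  ... | yes A>B | _ = A>B
  ... | no _ | no ∌A = RW (∌⇒impossible ∌A) (tautology (bot ⟶ v₀) (_ ∷ []))
  ... | no _ | yes xA with Minimal-∃ {N = Nbhd} m χ-≐ (proj₂ (χ-｛｝ x) refl) xA
  ... | y , y∈｛x｝ , _ , yB = ∋-mp₂ xA (subst (_∋ B) (proj₁ (χ-｛｝ y) y∈｛x｝) yB) (curry (ax-C hC))

  faithful : ∀ x A B → Minimal Nbhd x (_∋ A) (_∋ B) ⟺ (x ∋ A >̇ B)
  faithful x A B = mk⇔ Minimal⇒∋ ∋⇒Minimal

  open TruthLemma Nbhd Nbhd-nonempty faithful using (model)
  open Completeness Nbhd Nbhd-nonempty faithful public

  absolute : Absoluteness model
  absolute x α y α≐ yα γ with to (α≐ y) yα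
  ... | refl = id , id

  weaklyCentred : WeakCentering model
  weaklyCentred x α α≐ = from (α≐ x) refl

  inClass : Absoluteness model × Normality model × TotalReflexivity model ×
    WeakCentering model × Centering model
  inClass = absolute , (λ x → χ ｛ x ｝ , χ-≐) , (λ x → χ ｛ x ｝ , χ-≐ , proj₂ (χ-｛｝ x) refl) ,
    weaklyCentred , (weaklyCentred , λ x → χ ｛ x ｝ , χ-≐ , χ-｛｝)

mainTheorem3 : ExcludedMiddle 0ℓ → (L : Logic) (F : Fm) →
    ((M : Model) → InClass L M → ValidIn M F) → L ⊢ F
mainTheorem3 em PN = let open Canonical em PN in complete (normal refl)
mainTheorem3 em PT = let open Canonical em PT in complete (normal refl , totallyReflexive refl)
mainTheorem3 em PC = let open Canonical em PC in
  complete (normal refl , totallyReflexive refl , weaklyCentred refl , centred refl)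
mainTheorem3 em PU = let open Canonical em PU in complete (uniform refl)
mainTheorem3 em PNU = let open Canonical em PNU in complete (uniform refl , normal refl)
mainTheorem3 em PTU = let open Canonical em PTU in
  complete (uniform refl , normal refl , totallyReflexive refl)
mainTheorem3 em PCU = let open Canonical em PCU in
  complete (uniform refl , normal refl , totallyReflexive refl , weaklyCentred refl , centred refl)
mainTheorem3 em PNA = let open Canonical em PNA in complete (absolute refl refl , normal refl)
mainTheorem3 em PTA = let open Canonical em PTA in
  complete (absolute refl refl , normal refl , totallyReflexive refl)
mainTheorem3 em PCA = let open Degenerate em PCA refl refl in complete inClass
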